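{- Let $S\subseteq\mathbb{N}^d$ be a generalized numerical semigroup. A gap $h\in\mathcal{H}(S)$ is Frobenius allowable if and only if $h$ is a maximal element of $\mathcal{H}(S)$ with respect to the natural partial ordering on $\mathbb{N}^d$.
   Context: A generalized numerical semigroup (GNS) is a submonoid $S\subseteq\mathbb{N}^d$ (contains $0$, closed under addition) with $\mathbb{N}^d\setminus S$ finite; $\mathcal{H}(S)=\mathbb{N}^d\setminus S$ is the set of gaps. The natural partial ordering: $x\le y$ iff $x^{(i)}\le y^{(i)}$ for all $i$. A relaxed monomial order is a total order $\prec$ on $\mathbb{N}^d$ such that (i) if $v\prec w$ then $v\prec w+u$ for all $u\in\mathbb{N}^d$, and (ii) $0\prec v$ for all nonzero $v$. For such $\prec$, $F_\prec(S)=\max_\prec\mathcal{H}(S)$. A gap is Frobenius allowable if it equals $F_\prec(S)$ for some relaxed monomial order $\prec$. -}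

module Defs where

open import Level using (0ℓ)
open import Data.Nat using (ℕ; _+_; _≤_)
open import Data.Vec using (Vec; zipWith; replicate)
open import Data.Vec.Relation.Binary.Pointwise.Inductive using (Pointwise)
open import Data.List using (List)
open import Data.List.Membership.Propositional using (_∈_)
open import Data.Product using (Σ; ∃; _×_; _,_)
open import Function.Bundles using (_⇔_)
open import Relation.Nullary using (¬_)
open import Relation.Binary.PropositionalEquality using (_≡_; _≢_)
open import Relation.Binary.Structures using (IsStrictTotalOrder)

ℕ^ : ℕ → Set
ℕ^ d = Vec ℕ d

𝟎 : ∀ {d} → ℕ^ d
𝟎 {d} = replicate d 0

_⊕_ : ∀ {d} → ℕ^ d → ℕ^ d → ℕ^ d
_⊕_ = zipWith _+_

_≤ₙ_ : ∀ {d} → ℕ^ d → ℕ^ d → Set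
_≤ₙ_ = Pointwise _≤_

Subset : ℕ → Set₁
Subset d = ℕ^ d → Set

IsGap : ∀ {d} → Subset d → ℕ^ d → Set
IsGap S x = ¬ S x

record IsGNS {d : ℕ} (S : Subset d) : Set₁ where
  field
    zero∈ : S 𝟎
    closed : ∀ x y → S x → S y → S (x ⊕ y)
    finiteGaps : Σ (List (ℕ^ d)) λ L → ∀ x → (x ∈ L ⇔ IsGap S x)

record IsRelaxedMonomialOrder {d : ℕ} (_≺_ : ℕ^ d → ℕ^ d → Set) : Set where
  field
    isStrictTotalOrder : IsStrictTotalOrder _≡_ _≺_
    compat : ∀ v w u → v ≺ w → v ≺ (w ⊕ u)
    zero-least : ∀ v → v ≢ 𝟎 → 𝟎 ≺ v

IsFrobenius : ∀ {d} → (ℕ^ d → ℕ^ d → Set) → Subset d → ℕ^ d → Set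
IsFrobenius _≺_ S h = IsGap S h × (∀ g → IsGap S g → g ≢ h → g ≺ h)

FrobeniusAllowable : ∀ {d} → Subset d → ℕ^ d → Set₁
FrobeniusAllowable {d} S h =
  Σ (ℕ^ d → ℕ^ d → Set) λ _≺_ → IsRelaxedMonomialOrder _≺_ × IsFrobenius _≺_ S h

IsMaximalGap : ∀ {d} → Subset d → ℕ^ d → Set
IsMaximalGap S h = ∀ g → IsGap S g → h ≤ₙ g → g ≡ h

-- A relaxed monomial order refines the natural partial order: if h ≤ g then g = h + u, so
-- g ≺ h would give g ≺ h + u = g. Hence a Frobenius allowable gap h has no larger gap above it.
-- Conversely, for a maximal gap h, order ℕ^d lexicographically by the key (𝟙[h ≤ v], v): every
-- element of the up-set of h comes after every element outside it, and since the key is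
-- injective and monotone this is a relaxed monomial order. The gaps other than h all lie
-- outside the up-set of h, so h is the largest gap.
module Submission where

open import Defs
open import Data.Nat using (ℕ; suc; _<_; _≤_; _∸_; z≤n; s≤s)
open import Data.Nat.Properties using (_≟_; _≤?_; ≤-refl; ≤-trans; m≤m+n; m+[n∸m]≡n; m≤n⇒m<n∨m≡n; <-isStrictTotalOrder)
open import Data.Vec using ([]; _∷_)
open import Data.Vec.Properties using (≡-dec; ∷-injectiveʳ)
open import Data.Vec.Relation.Binary.Pointwise.Inductive as Pointwise using (Pointwise; []; _∷_; Pointwise-≡⇒≡; ≡⇒Pointwise-≡)
open import Data.Vec.Relation.Binary.Lex.Strict as Lex using (Lex-<; this; next)
open import Data.Product using (∃; _,_)
open import Data.Sum using (_⊎_; inj₁; inj₂)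
open import Function using (_∘_; _on_)
open import Function.Bundles using (_⇔_; mk⇔)
open import Function.Definitions using (Injective)
open import Relation.Binary.Definitions using (Monotonic₁; tri<; tri≈; tri>; Trichotomous)
open import Relation.Binary.Consequences using (tri⇒irr)
open import Relation.Binary.PropositionalEquality using (_≡_; _≢_; refl; sym; cong; cong₂; isEquivalence)
open import Relation.Binary.Structures using (IsStrictTotalOrder)
open import Relation.Nullary using (¬_; Dec; yes; no; contradiction)

≤ₙ-refl : ∀ {d} {v : ℕ^ d} → v ≤ₙ v
≤ₙ-refl = Pointwise.refl ≤-refl

≤ₙ-trans : ∀ {d} {u v w : ℕ^ d} → u ≤ₙ v → v ≤ₙ w → u ≤ₙ w
≤ₙ-trans = Pointwise.trans ≤-trans

_≤ₙ?_ : ∀ {d} (v w : ℕ^ d) → Dec (v ≤ₙ w)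
_≤ₙ?_ = Pointwise.decidable _≤?_

𝟎-≤ₙ : ∀ {d} (v : ℕ^ d) → 𝟎 ≤ₙ v
𝟎-≤ₙ []      = []
𝟎-≤ₙ (_ ∷ v) = z≤n ∷ 𝟎-≤ₙ v

≤ₙ-⊕ : ∀ {d} (v u : ℕ^ d) → v ≤ₙ (v ⊕ u)
≤ₙ-⊕ []      []      = []
≤ₙ-⊕ (a ∷ v) (b ∷ u) = m≤m+n a b ∷ ≤ₙ-⊕ v u

≤ₙ⇒∃⊕ : ∀ {d} {v w : ℕ^ d} → v ≤ₙ w → ∃ λ u → v ⊕ u ≡ w
≤ₙ⇒∃⊕ []                          = [] , refl
≤ₙ⇒∃⊕ {v = a ∷ _} {w = b ∷ _} (a≤b ∷ v≤w) with ≤ₙ⇒∃⊕ v≤w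
... | u , v⊕u≡w = b ∸ a ∷ u , cong₂ _∷_ (m+[n∸m]≡n a≤b) v⊕u≡w

≤ₙ⇒¬≻ : ∀ {d} {_≺_ : ℕ^ d → ℕ^ d → Set} → IsRelaxedMonomialOrder _≺_ →
        ∀ {v w} → v ≤ₙ w → ¬ (w ≺ v)
≤ₙ⇒¬≻ {_≺_ = _≺_} rmo {v} v≤w w≺v with ≤ₙ⇒∃⊕ v≤w
... | u , refl = irrefl refl (compat (v ⊕ u) v u w≺v)
  where
  open IsRelaxedMonomialOrder rmo
  open IsStrictTotalOrder isStrictTotalOrder using (irrefl)

_<ₗ_ : ∀ {d} → ℕ^ d → ℕ^ d → Set
_<ₗ_ = Lex-< _≡_ _<_

<ₗ-isStrictTotalOrder : ∀ {d} → IsStrictTotalOrder (Pointwise _≡_) (_<ₗ_ {d})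
<ₗ-isStrictTotalOrder = Lex.<-isStrictTotalOrder <-isStrictTotalOrder

≤ₙ⇒≡⊎<ₗ : ∀ {d} {v w : ℕ^ d} → v ≤ₙ w → v ≡ w ⊎ v <ₗ w
≤ₙ⇒≡⊎<ₗ []            = inj₁ refl
≤ₙ⇒≡⊎<ₗ (a≤b ∷ v≤w) with m≤n⇒m<n∨m≡n a≤b | ≤ₙ⇒≡⊎<ₗ v≤w
... | inj₁ a<b  | _          = inj₂ (this a<b refl)
... | inj₂ refl | inj₁ refl  = inj₁ refl
... | inj₂ refl | inj₂ v<ₗw  = inj₂ (next refl v<ₗw)

<ₗ-≤ₙ-trans : ∀ {d} {u v w : ℕ^ d} → u <ₗ v → v ≤ₙ w → u <ₗ w
<ₗ-≤ₙ-trans u<ₗv v≤w with ≤ₙ⇒≡⊎<ₗ v≤w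
... | inj₁ refl = u<ₗv
... | inj₂ v<ₗw = IsStrictTotalOrder.trans <ₗ-isStrictTotalOrder u<ₗv v<ₗw

module _ {d e} (f : ℕ^ d → ℕ^ e) (f-injective : Injective _≡_ _≡_ f)
         (f-monotone : Monotonic₁ _≤ₙ_ _≤ₙ_ f) where

  private
    _≺_ : ℕ^ d → ℕ^ d → Set
    _≺_ = _<ₗ_ on f
    open IsStrictTotalOrder (<ₗ-isStrictTotalOrder {e}) using (trans; compare)

  ≺-compare : Trichotomous _≡_ _≺_
  ≺-compare v w with compare (f v) (f w)
  ... | tri< lt ¬eq ¬gt = tri< lt (¬eq ∘ ≡⇒Pointwise-≡ ∘ cong f) ¬gt
  ... | tri≈ ¬lt eq ¬gt = tri≈ ¬lt (f-injective (Pointwise-≡⇒≡ eq)) ¬gt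
  ... | tri> ¬lt ¬eq gt = tri> ¬lt (¬eq ∘ ≡⇒Pointwise-≡ ∘ cong f) gt

  on-isRelaxedMonomialOrder : IsRelaxedMonomialOrder _≺_
  on-isRelaxedMonomialOrder = record
    { isStrictTotalOrder = record
      { isStrictPartialOrder = record
        { isEquivalence = isEquivalence
        ; irrefl        = tri⇒irr ≺-compare
        ; trans         = trans
        ; <-resp-≈      = (λ { refl → λ v≺w → v≺w }) , (λ { refl → λ v≺w → v≺w })
        }
      ; compare = ≺-compare
      }
    ; compat     = λ v w u v≺w → <ₗ-≤ₙ-trans v≺w (f-monotone (≤ₙ-⊕ w u))
    ; zero-least = 𝟎≺
    }
    where
    𝟎≺ : ∀ v → v ≢ 𝟎 → 𝟎 ≺ v
    𝟎≺ v v≢𝟎 with ≤ₙ⇒≡⊎<ₗ (f-monotone (𝟎-≤ₙ v))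
    ... | inj₁ f𝟎≡fv = contradiction (sym (f-injective f𝟎≡fv)) v≢𝟎
    ... | inj₂ f𝟎<ₗfv = f𝟎<ₗfv

𝟙[_] : ∀ {A : Set} → Dec A → ℕ
𝟙[ yes _ ] = 1
𝟙[ no _ ]  = 0

𝟙-mono : ∀ {A B : Set} → (A → B) → (a? : Dec A) (b? : Dec B) → 𝟙[ a? ] ≤ 𝟙[ b? ]
𝟙-mono _   (yes _) (yes _) = ≤-refl
𝟙-mono A⇒B (yes a) (no ¬b) = contradiction (A⇒B a) ¬b
𝟙-mono _   (no _)  _       = z≤n

upsetKey : ∀ {d} → ℕ^ d → ℕ^ d → ℕ^ (suc d)
upsetKey h v = 𝟙[ h ≤ₙ? v ] ∷ v

upsetKey-injective : ∀ {d} (h : ℕ^ d) → Injective _≡_ _≡_ (upsetKey h)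
upsetKey-injective h = ∷-injectiveʳ

upsetKey-monotone : ∀ {d} (h : ℕ^ d) → Monotonic₁ _≤ₙ_ _≤ₙ_ (upsetKey h)
upsetKey-monotone h {v} {w} v≤w = 𝟙-mono (λ h≤v → ≤ₙ-trans h≤v v≤w) (h ≤ₙ? v) (h ≤ₙ? w) ∷ v≤w

UpsetLast : ∀ {d} → ℕ^ d → ℕ^ d → ℕ^ d → Set
UpsetLast h = _<ₗ_ on upsetKey h

upsetLast-isRelaxedMonomialOrder : ∀ {d} (h : ℕ^ d) → IsRelaxedMonomialOrder (UpsetLast h)
upsetLast-isRelaxedMonomialOrder h = on-isRelaxedMonomialOrder (upsetKey h) (upsetKey-injective h) (upsetKey-monotone h)

upsetLast : ∀ {d} (h : ℕ^ d) {v w} → ¬ h ≤ₙ v → h ≤ₙ w → UpsetLast h v w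
upsetLast h {v} {w} h≰v h≤w with h ≤ₙ? v | h ≤ₙ? w
... | yes h≤v | _      = contradiction h≤v h≰v
... | no _    | yes _  = this (s≤s z≤n) refl
... | no _    | no h≰w = contradiction h≤w h≰w

theorem2p1 : (d : ℕ) (S : Subset d) → IsGNS S → (h : ℕ^ d) → IsGap S h →
    (FrobeniusAllowable S h ⇔ IsMaximalGap S h)
theorem2p1 d S _ h h-gap = mk⇔ allowable⇒maximal maximal⇒allowable
  where
  allowable⇒maximal : FrobeniusAllowable S h → IsMaximalGap S h
  allowable⇒maximal (_ , rmo , _ , below-h) g g-gap h≤g with ≡-dec _≟_ g h
  ... | yes g≡h = g≡h
  ... | no g≢h  = contradiction (below-h g g-gap g≢h) (≤ₙ⇒¬≻ rmo h≤g)

  maximal⇒allowable : IsMaximalGap S h → FrobeniusAllowable S h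
  maximal⇒allowable maximal =
    _ , upsetLast-isRelaxedMonomialOrder h , h-gap ,
    λ g g-gap g≢h → upsetLast h (g≢h ∘ maximal g g-gap) ≤ₙ-refl
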